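{- Let $n=2m$ be an even positive integer and let $A=[a_0,\dots,a_{n-1}]$, $B=[b_0,\dots,b_{n-1}]$, $C=[c_0,\dots,c_{n-1}]$, $D=[d_0,\dots,d_{n-1}]$ be a Williamson sequence of order $n$. Then $a_ib_ic_id_i=a_{i+m}b_{i+m}c_{i+m}d_{i+m}$ for all $0\le i<m$.
   Context: A sequence $X=[x_0,\dots,x_{n-1}]$ is symmetric if $x_i=x_{n-i}$ for $1\le i<n$. The periodic autocorrelation function of $X$ is $\mathrm{PAF}_X(s)=\sum_{k=0}^{n-1}x_kx_{(k+s)\bmod n}$. Four symmetric sequences $A,B,C,D\in\{\pm1\}^n$ form a Williamson sequence of order $n$ if $\mathrm{PAF}_A(s)+\mathrm{PAF}_B(s)+\mathrm{PAF}_C(s)+\mathrm{PAF}_D(s)=0$ for $s=1,\dots,\lfloor n/2\rfloor$. -}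

module Defs where

open import Data.Nat as ℕ using (ℕ; zero; suc; NonZero; _<_; _≤_)
open import Data.Nat.DivMod using (_%_; _/_; m%n<n)
open import Data.Fin using (Fin; fromℕ<; toℕ)
open import Data.Integer as ℤ using (ℤ; +_; -[1+_])
open import Data.Product using (_×_)
open import Data.Sum using (_⊎_)
open import Relation.Binary.PropositionalEquality using (_≡_)

Seq : ℕ → Set
Seq n = Fin n → ℤ

IsPM1 : ∀ {n} → Seq n → Set
IsPM1 {n} X = ∀ (i : Fin n) → (X i ≡ + 1) ⊎ (X i ≡ -[1+ 0 ])

at : ∀ {n} .{{_ : NonZero n}} → Seq n → ℕ → ℤ
at {n} X k = X (fromℕ< (m%n<n k n))

sumTo : ℕ → (ℕ → ℤ) → ℤ
sumTo zero    f = + 0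
sumTo (suc n) f = sumTo n f ℤ.+ f n

Symmetric : ∀ {n} .{{_ : NonZero n}} → Seq n → Set
Symmetric {n} X = ∀ (i : ℕ) → 1 ≤ i → i < n → at X i ≡ at X (n ℕ.∸ i)

PAF : ∀ {n} .{{_ : NonZero n}} → Seq n → ℕ → ℤ
PAF {n} X s = sumTo n (λ k → at X k ℤ.* at X (k ℕ.+ s))

Williamson : ∀ {n} .{{_ : NonZero n}} → (A B C D : Seq n) → Set
Williamson {n} A B C D =
  (IsPM1 A × IsPM1 B × IsPM1 C × IsPM1 D) ×
  (Symmetric A × Symmetric B × Symmetric C × Symmetric D) ×
  (∀ (s : ℕ) → 1 ≤ s → s ≤ n / 2 →
     PAF A s ℤ.+ PAF B s ℤ.+ PAF C s ℤ.+ PAF D s ≡ + 0)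

-- Write each ±1 entry as x = 1 - 2β with β ∈ {0,1}.  For a ±1 sequence of length n this gives
-- PAF(s) = n + 4 (Q(s) - W), where W is the number of -1 entries and Q(s) = Σ β_k β_{k+s};
-- hence for a Williamson quadruple the total Q(s) does not depend on s ∈ [1, m].  By symmetry
-- the terms of Q(1) pair up, so Q(1) is even, while the terms of Q(2j) pair up except for the
-- fixed points j and j + m, so Q(2j) ≡ β_j + β_{j+m} (mod 2).  Therefore the number of -1
-- entries among the eight values at positions i and i + m is even whenever 2i ≤ m, hence for
-- all 0 < i < m by the symmetry i ↦ m - i, and for i = 0 because the total number of -1
-- entries, 2m + Q(1), is even.  An even number of -1 factors means the two products agree.
module Submission where

open import Defs

module WilliamsonParity where

  open import Data.Empty using (⊥-elim)
  open import Data.Fin.Properties using (fromℕ<-cong)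
  open import Data.Integer using (ℤ; +_; -[1+_]; 0ℤ; 1ℤ; -1ℤ; _+_; _-_; _*_; -_)
  open import Data.Integer.Divisibility.Signed using (_∣_; divides; ∣⇒∣ᵤ; ∣m∣n⇒∣m+n; ∣m∣n⇒∣m-n; ∣m+n∣n⇒∣m)
  open import Data.Integer.Properties
    using (+-comm; +-assoc; +-identityˡ; +-identityʳ; *-comm; *-identityˡ; *-identityʳ; *-zeroˡ; *-zeroʳ; *-distribˡ-+; *-cancelˡ-≡; pos-+; +-0-abelianGroup)
  open import Algebra.Properties.AbelianGroup +-0-abelianGroup using (∙-cancelˡ; ∙-cancelʳ)
  open import Data.Integer.Tactic.RingSolver using (solve-∀)
  open import Data.Nat as ℕ using (ℕ; zero; suc; _≤_; _<_; _∸_; NonZero; z≤n; s≤s; _≤?_)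
  import Data.Nat.Properties as ℕ
  open import Data.Nat.Divisibility using (∣1⇒≡1)
  open import Data.Nat.DivMod using (_%_; _/_; m%n<n; [m+n]%n≡m%n; m*n/n≡m)
  import Data.Nat.Tactic.RingSolver as ℕ-Ring
  open import Data.Sum using (_⊎_; inj₁; inj₂)
  open import Data.Product using (_,_)
  open import Function using (_∘_)
  open import Relation.Nullary using (¬_; yes; no)
  open import Relation.Binary.PropositionalEquality
  open ≡-Reasoning

  -- Finite sums

  sumTo-cong : ∀ L {f g : ℕ → ℤ} → (∀ k → k < L → f k ≡ g k) → sumTo L f ≡ sumTo L g
  sumTo-cong zero    f≗g = refl
  sumTo-cong (suc L) f≗g =
    cong₂ _+_ (sumTo-cong L (λ k k<L → f≗g k (ℕ.m<n⇒m<1+n k<L))) (f≗g L (ℕ.n<1+n L))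

  sumTo-+ : ∀ L (f g : ℕ → ℤ) → sumTo L (λ k → f k + g k) ≡ sumTo L f + sumTo L g
  sumTo-+ zero    f g = refl
  sumTo-+ (suc L) f g = trans (cong (_+ (f L + g L)) (sumTo-+ L f g)) (interchange (sumTo L f) (sumTo L g) (f L) (g L))
    where
    interchange : ∀ a b c d → (a + b) + (c + d) ≡ (a + c) + (b + d)
    interchange = solve-∀

  sumTo-*ˡ : ∀ L c (f : ℕ → ℤ) → sumTo L (λ k → c * f k) ≡ c * sumTo L f
  sumTo-*ˡ zero    c f = sym (*-zeroʳ c)
  sumTo-*ˡ (suc L) c f = trans (cong (_+ c * f L) (sumTo-*ˡ L c f)) (sym (*-distribˡ-+ c (sumTo L f) (f L)))

  sumTo-sub : ∀ L (f g : ℕ → ℤ) → sumTo L (λ k → f k - g k) ≡ sumTo L f - sumTo L g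
  sumTo-sub zero    f g = refl
  sumTo-sub (suc L) f g = trans (cong (_+ (f L - g L)) (sumTo-sub L f g)) (interchange (sumTo L f) (sumTo L g) (f L) (g L))
    where
    interchange : ∀ a b c d → (a - b) + (c - d) ≡ (a + c) - (b + d)
    interchange = solve-∀

  sumTo-const : ∀ L c → sumTo L (λ _ → c) ≡ + L * c
  sumTo-const zero    c = sym (*-zeroˡ c)
  sumTo-const (suc L) c = begin
    sumTo L (λ _ → c) + c  ≡⟨ cong (_+ c) (sumTo-const L c) ⟩
    + L * c + c            ≡⟨ step (+ L) c ⟩
    (1ℤ + + L) * c         ≡⟨ cong (_* c) (pos-+ 1 L) ⟨
    + suc L * c            ∎
    where
    step : ∀ l c → l * c + c ≡ (1ℤ + l) * c
    step = solve-∀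

  sumTo-split : ∀ K L (f : ℕ → ℤ) → sumTo (K ℕ.+ L) f ≡ sumTo K f + sumTo L (λ k → f (K ℕ.+ k))
  sumTo-split K zero    f = trans (cong (λ n → sumTo n f) (ℕ.+-identityʳ K)) (sym (+-identityʳ (sumTo K f)))
  sumTo-split K (suc L) f = begin
    sumTo (K ℕ.+ suc L) f                                     ≡⟨ cong (λ n → sumTo n f) (ℕ.+-suc K L) ⟩
    sumTo (K ℕ.+ L) f + f (K ℕ.+ L)                           ≡⟨ cong (_+ f (K ℕ.+ L)) (sumTo-split K L f) ⟩
    sumTo K f + sumTo L (λ k → f (K ℕ.+ k)) + f (K ℕ.+ L)     ≡⟨ +-assoc (sumTo K f) _ _ ⟩
    sumTo K f + sumTo (suc L) (λ k → f (K ℕ.+ k))             ∎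

  sumTo-head : ∀ L (f : ℕ → ℤ) → sumTo (suc L) f ≡ f 0 + sumTo L (f ∘ suc)
  sumTo-head L f = trans (sumTo-split 1 L f) (cong (_+ sumTo L (f ∘ suc)) (+-identityˡ (f 0)))

  sumTo-halves : ∀ N (f : ℕ → ℤ) → sumTo (N ℕ.+ N) f ≡ sumTo N (λ i → f i + f (i ℕ.+ N))
  sumTo-halves N f = begin
    sumTo (N ℕ.+ N) f                                  ≡⟨ sumTo-split N N f ⟩
    sumTo N f + sumTo N (λ i → f (N ℕ.+ i))            ≡⟨ cong (λ z → sumTo N f + z) (sumTo-cong N (λ i _ → cong f (ℕ.+-comm N i))) ⟩
    sumTo N f + sumTo N (λ i → f (i ℕ.+ N))            ≡⟨ sumTo-+ N f (λ i → f (i ℕ.+ N)) ⟨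
    sumTo N (λ i → f i + f (i ℕ.+ N))                  ∎

  sumTo-swap : ∀ L K (f : ℕ → ℕ → ℤ) → sumTo L (λ i → sumTo K (λ t → f t i)) ≡ sumTo K (λ t → sumTo L (f t))
  sumTo-swap zero    K f = sym (trans (sumTo-const K 0ℤ) (*-zeroʳ (+ K)))
  sumTo-swap (suc L) K f = begin
    sumTo L (λ i → sumTo K (λ t → f t i)) + sumTo K (λ t → f t L)   ≡⟨ cong (_+ sumTo K (λ t → f t L)) (sumTo-swap L K f) ⟩
    sumTo K (λ t → sumTo L (f t)) + sumTo K (λ t → f t L)           ≡⟨ sumTo-+ K (λ t → sumTo L (f t)) (λ t → f t L) ⟨
    sumTo K (λ t → sumTo (suc L) (f t))                             ∎

  sumTo-reverse : ∀ L (f : ℕ → ℤ) → sumTo L f ≡ sumTo L (λ k → f (L ∸ suc k))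
  sumTo-reverse zero    f = refl
  sumTo-reverse (suc L) f = begin
    sumTo L f + f L                          ≡⟨ cong (_+ f L) (sumTo-reverse L f) ⟩
    sumTo L (λ k → f (L ∸ suc k)) + f L      ≡⟨ +-comm (sumTo L (λ k → f (L ∸ suc k))) (f L) ⟩
    f L + sumTo L (λ k → f (L ∸ suc k))      ≡⟨ sumTo-head L (λ k → f (suc L ∸ suc k)) ⟨
    sumTo (suc L) (λ k → f (suc L ∸ suc k))  ∎

  sumTo-reflect : ∀ L {f g : ℕ → ℤ} → (∀ a c → suc (a ℕ.+ c) ≡ L → f a ≡ g c) → sumTo L f ≡ sumTo L g
  sumTo-reflect L {f} f≗g = trans (sumTo-reverse L f) (sumTo-cong L (λ k k<L → f≗g (L ∸ suc k) k (mirror k<L)))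
    where
    mirror : ∀ {k} → k < L → suc (L ∸ suc k ℕ.+ k) ≡ L
    mirror {k} k<L = trans (sym (ℕ.+-suc (L ∸ suc k) k)) (ℕ.m∸n+n≡m k<L)

  Periodic : ℕ → (ℕ → ℤ) → Set
  Periodic n f = ∀ k → f (k ℕ.+ n) ≡ f k

  sumTo-shift : ∀ n {g : ℕ → ℤ} → Periodic n g → ∀ c → sumTo n (λ k → g (k ℕ.+ c)) ≡ sumTo n g
  sumTo-shift n {g} per zero    = sumTo-cong n (λ k _ → cong g (ℕ.+-identityʳ k))
  sumTo-shift n {g} per (suc c) = begin
    sumTo n (λ k → g (k ℕ.+ suc c))  ≡⟨ sumTo-cong n (λ k _ → cong g (ℕ.+-suc k c)) ⟩
    sumTo n (h ∘ suc)                ≡⟨ ∙-cancelˡ (h 0) (sumTo n (h ∘ suc)) (sumTo n h) rotate ⟩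
    sumTo n h                        ≡⟨ sumTo-shift n per c ⟩
    sumTo n g                        ∎
    where
    h : ℕ → ℤ
    h k = g (k ℕ.+ c)
    -- the term leaving the window at the front re-enters at the back, by periodicity
    rotate : h 0 + sumTo n (h ∘ suc) ≡ h 0 + sumTo n h
    rotate = begin
      h 0 + sumTo n (h ∘ suc)  ≡⟨ sumTo-head n h ⟨
      sumTo n h + h n          ≡⟨ cong (λ z → sumTo n h + z) (trans (cong g (ℕ.+-comm n c)) (per c)) ⟩
      sumTo n h + h 0          ≡⟨ +-comm (sumTo n h) (h 0) ⟩
      h 0 + sumTo n h          ∎

  -- Parity and palindromes

  Even : ℤ → Set
  Even z = + 2 ∣ z

  even-double : ∀ z → Even (z + z)
  even-double z = divides z (double z)
    where
    double : ∀ z → z + z ≡ z * + 2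
    double = solve-∀

  odd-1 : ¬ Even 1ℤ
  odd-1 2∣1 with ∣1⇒≡1 (∣⇒∣ᵤ 2∣1)
  ... | ()

  sumTo-even : ∀ L {f : ℕ → ℤ} → (∀ k → k < L → Even (f k)) → Even (sumTo L f)
  sumTo-even zero    _    = divides 0ℤ refl
  sumTo-even (suc L) even = ∣m∣n⇒∣m+n (sumTo-even L (λ k k<L → even k (ℕ.m<n⇒m<1+n k<L))) (even L (ℕ.n<1+n L))

  even-first-term : ∀ L {f : ℕ → ℤ} → 0 < L → Even (sumTo L f) → (∀ k → 0 < k → k < L → Even (f k)) → Even (f 0)
  even-first-term (suc L) {f} _ even-sum even-rest = ∣m+n∣n⇒∣m (subst Even (sumTo-head L f) even-sum)
    (sumTo-even L (λ k k<L → even-rest (suc k) (s≤s z≤n) (s≤s k<L)))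

  -- f↾[0, L) reads the same backwards; Palindrome (suc n) x is the symmetry x_i = x_{n-i}.
  Palindrome : ℕ → (ℕ → ℤ) → Set
  Palindrome L f = ∀ a c → suc (a ℕ.+ c) ≡ L → f a ≡ f c

  sumTo-palindrome : ∀ L (f : ℕ → ℤ) → Palindrome (L ℕ.+ L) f → sumTo (L ℕ.+ L) f ≡ sumTo L f + sumTo L f
  sumTo-palindrome L f pal = trans (sumTo-split L L f) (cong (λ z → sumTo L f + z) (sumTo-reflect L upper))
    where
    upper : ∀ a c → suc (a ℕ.+ c) ≡ L → f (L ℕ.+ a) ≡ f c
    upper a c e = pal (L ℕ.+ a) c (begin
      suc (L ℕ.+ a ℕ.+ c)      ≡⟨ cong suc (ℕ.+-assoc L a c) ⟩
      suc (L ℕ.+ (a ℕ.+ c))    ≡⟨ ℕ.+-suc L (a ℕ.+ c) ⟨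
      L ℕ.+ suc (a ℕ.+ c)      ≡⟨ cong (L ℕ.+_) e ⟩
      L ℕ.+ L                  ∎)

  -- On a window of even length 2N whose reflection k ↦ 2N - k fixes 0 and N, all other terms pair up.
  sumTo-palindrome-ends : ∀ N .{{_ : NonZero N}} (f : ℕ → ℤ) → Palindrome (suc (N ℕ.+ N)) f →
                          Even (sumTo (N ℕ.+ N) f - (f 0 + f N))
  sumTo-palindrome-ends N@(suc M) f pal = divides S (begin
    sumTo (N ℕ.+ N) f - (f 0 + f N)       ≡⟨ cong (_- (f 0 + f N)) split ⟩
    (f 0 + S) + (f N + S) - (f 0 + f N)   ≡⟨ regroup (f 0) (f N) S ⟩
    S * + 2                               ∎)
    where
    S : ℤ
    S = sumTo M (f ∘ suc)
    upper : ∀ a c → suc (a ℕ.+ c) ≡ M → f (N ℕ.+ suc a) ≡ f (suc c)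
    upper a c e = pal (N ℕ.+ suc a) (suc c) (cong suc (begin
      N ℕ.+ suc a ℕ.+ suc c        ≡⟨ ℕ.+-assoc N (suc a) (suc c) ⟩
      N ℕ.+ suc (a ℕ.+ suc c)      ≡⟨ cong (λ z → N ℕ.+ suc z) (trans (ℕ.+-suc a c) e) ⟩
      N ℕ.+ N                      ∎))
    split : sumTo (N ℕ.+ N) f ≡ (f 0 + S) + (f N + S)
    split = begin
      sumTo (N ℕ.+ N) f                                              ≡⟨ sumTo-split N N f ⟩
      sumTo N f + sumTo N (λ k → f (N ℕ.+ k))                        ≡⟨ cong₂ _+_ (sumTo-head M f) (sumTo-head M (λ k → f (N ℕ.+ k))) ⟩
      (f 0 + S) + (f (N ℕ.+ 0) + sumTo M (λ k → f (N ℕ.+ suc k)))    ≡⟨ cong₂ (λ u v → (f 0 + S) + (f u + v)) (ℕ.+-identityʳ N) (sumTo-reflect M upper) ⟩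
      (f 0 + S) + (f N + S)                                          ∎
    regroup : ∀ a b s → (a + s) + (b + s) - (a + b) ≡ s * + 2
    regroup = solve-∀

  palindrome-+period : ∀ {n K f} → Periodic n f → n ≤ K → Palindrome (suc K) f → Palindrome (suc (K ℕ.+ n)) f
  palindrome-+period {n} {K} {f} per n≤K pal a c eq = mirror a c (ℕ.suc-injective eq)
    where
    descend : ∀ a c → n ≤ a → a ℕ.+ c ≡ K ℕ.+ n → f a ≡ f c
    descend a c n≤a e = begin
      f a              ≡⟨ cong f (ℕ.m∸n+n≡m n≤a) ⟨
      f (a ∸ n ℕ.+ n)  ≡⟨ per (a ∸ n) ⟩
      f (a ∸ n)        ≡⟨ pal (a ∸ n) c (cong suc (begin
        a ∸ n ℕ.+ c      ≡⟨ ℕ.+-∸-comm c n≤a ⟨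
        a ℕ.+ c ∸ n      ≡⟨ cong (_∸ n) e ⟩
        K ℕ.+ n ∸ n      ≡⟨ ℕ.m+n∸n≡m K n ⟩
        K                ∎)) ⟩
      f c              ∎
    mirror : ∀ a c → a ℕ.+ c ≡ K ℕ.+ n → f a ≡ f c
    mirror a c e with n ≤? a | n ≤? c
    ... | yes n≤a | _       = descend a c n≤a e
    ... | no _    | yes n≤c = sym (descend c a n≤c (trans (ℕ.+-comm c a) e))
    ... | no n≰a  | no n≰c  =
      ⊥-elim (ℕ.<-irrefl e (ℕ.<-≤-trans (ℕ.+-mono-< (ℕ.≰⇒> n≰a) (ℕ.≰⇒> n≰c)) (ℕ.+-monoˡ-≤ n n≤K)))

  PlusMinusOne : ℤ → Set
  PlusMinusOne z = z ≡ 1ℤ ⊎ z ≡ -1ℤ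

  -- the 0/1 value β with x = 1 - 2β for x = ±1
  negBit : ℤ → ℤ
  negBit (+ _)    = 0ℤ
  negBit -[1+ _ ] = 1ℤ

  negBit-idem : ∀ z → negBit z * negBit z ≡ negBit z
  negBit-idem (+ _)    = refl
  negBit-idem -[1+ _ ] = refl

  pm1≡1-2negBit : ∀ {z} → PlusMinusOne z → z ≡ 1ℤ - + 2 * negBit z
  pm1≡1-2negBit (inj₁ refl) = refl
  pm1≡1-2negBit (inj₂ refl) = refl

  pm1-* : ∀ {x y} → PlusMinusOne x → PlusMinusOne y → PlusMinusOne (x * y)
  pm1-* (inj₁ refl) (inj₁ refl) = inj₁ refl
  pm1-* (inj₁ refl) (inj₂ refl) = inj₂ refl
  pm1-* (inj₂ refl) (inj₁ refl) = inj₂ refl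
  pm1-* (inj₂ refl) (inj₂ refl) = inj₁ refl

  negBit-* : ∀ {x y} → PlusMinusOne x → PlusMinusOne y → Even (negBit (x * y) - (negBit x + negBit y))
  negBit-* (inj₁ refl) (inj₁ refl) = divides 0ℤ refl
  negBit-* (inj₁ refl) (inj₂ refl) = divides 0ℤ refl
  negBit-* (inj₂ refl) (inj₁ refl) = divides 0ℤ refl
  negBit-* (inj₂ refl) (inj₂ refl) = divides -1ℤ refl

  pm1-≡ : ∀ {x y} → PlusMinusOne x → PlusMinusOne y → Even (negBit x + negBit y) → x ≡ y
  pm1-≡ (inj₁ refl) (inj₁ refl) _    = refl
  pm1-≡ (inj₂ refl) (inj₂ refl) _    = refl
  pm1-≡ (inj₁ refl) (inj₂ refl) even = ⊥-elim (odd-1 even)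
  pm1-≡ (inj₂ refl) (inj₁ refl) even = ⊥-elim (odd-1 even)

  productTo : ℕ → (ℕ → ℤ) → ℤ
  productTo zero    f = 1ℤ
  productTo (suc n) f = productTo n f * f n

  productTo-pm1 : ∀ r {u : ℕ → ℤ} → (∀ t → PlusMinusOne (u t)) → PlusMinusOne (productTo r u)
  productTo-pm1 zero    pm = inj₁ refl
  productTo-pm1 (suc r) pm = pm1-* (productTo-pm1 r pm) (pm r)

  negBit-productTo : ∀ r {u : ℕ → ℤ} → (∀ t → PlusMinusOne (u t)) →
                     Even (negBit (productTo r u) - sumTo r (negBit ∘ u))
  negBit-productTo zero        pm = divides 0ℤ refl
  negBit-productTo (suc r) {u} pm =
    subst Even (telescope (negBit (productTo (suc r) u)) (negBit (u r)) (negBit (productTo r u)) (sumTo r (negBit ∘ u)))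
      (∣m∣n⇒∣m+n (negBit-* (productTo-pm1 r pm) (pm r)) (negBit-productTo r pm))
    where
    telescope : ∀ p q a s → (p - (a + q)) + (a - s) ≡ p - (s + q)
    telescope = solve-∀

  productTo-≡ : ∀ r {u v : ℕ → ℤ} → (∀ t → PlusMinusOne (u t)) → (∀ t → PlusMinusOne (v t)) →
                Even (sumTo r (negBit ∘ u) + sumTo r (negBit ∘ v)) → productTo r u ≡ productTo r v
  productTo-≡ r {u} {v} pmu pmv even = pm1-≡ (productTo-pm1 r pmu) (productTo-pm1 r pmv)
    (subst Even (regroup (negBit (productTo r u)) (negBit (productTo r v)) (sumTo r (negBit ∘ u)) (sumTo r (negBit ∘ v)))
      (∣m∣n⇒∣m+n (∣m∣n⇒∣m+n (negBit-productTo r pmu) (negBit-productTo r pmv)) even))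
    where
    regroup : ∀ p q s s′ → ((p - s) + (q - s′)) + (s + s′) ≡ p + q
    regroup = solve-∀

  productTo-4 : ∀ u → productTo 4 u ≡ u 0 * u 1 * u 2 * u 3
  productTo-4 u = cong (λ z → z * u 1 * u 2 * u 3) (*-identityˡ (u 0))

  -- Autocorrelation of symmetric ±1 sequences

  autocorrelation : ℕ → (ℕ → ℤ) → ℕ → ℤ
  autocorrelation n f s = sumTo n (λ k → f k * f (k ℕ.+ s))

  autocorrelation-pm1 : ∀ n {x : ℕ → ℤ} → Periodic n x → (∀ k → PlusMinusOne (x k)) → ∀ s →
    autocorrelation n x s ≡ + n + + 4 * (autocorrelation n (negBit ∘ x) s - sumTo n (negBit ∘ x))
  autocorrelation-pm1 n {x} per pm s = begin
    sumTo n (λ k → x k * x (k ℕ.+ s))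
      ≡⟨ sumTo-cong n (λ k _ → trans (cong₂ _*_ (pm1≡1-2negBit (pm k)) (pm1≡1-2negBit (pm (k ℕ.+ s))))
                                      (expand (b k) (b (k ℕ.+ s)))) ⟩
    sumTo n (λ k → (1ℤ + + 4 * (b k * b (k ℕ.+ s))) + - + 2 * (b k + b (k ℕ.+ s)))
      ≡⟨ sumTo-+ n (λ k → 1ℤ + + 4 * (b k * b (k ℕ.+ s))) (λ k → - + 2 * (b k + b (k ℕ.+ s))) ⟩
    sumTo n (λ k → 1ℤ + + 4 * (b k * b (k ℕ.+ s))) + sumTo n (λ k → - + 2 * (b k + b (k ℕ.+ s)))
      ≡⟨ cong₂ _+_ quadratic linear ⟩
    (+ n + + 4 * Q) + - + 2 * (B + B)
      ≡⟨ collect (+ n) Q B ⟩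
    + n + + 4 * (Q - B)
      ∎
    where
    b : ℕ → ℤ
    b = negBit ∘ x
    B Q : ℤ
    B = sumTo n b
    Q = autocorrelation n b s
    expand : ∀ p q → (1ℤ - + 2 * p) * (1ℤ - + 2 * q) ≡ (1ℤ + + 4 * (p * q)) + - + 2 * (p + q)
    expand = solve-∀
    collect : ∀ m q w → (m + + 4 * q) + - + 2 * (w + w) ≡ m + + 4 * (q - w)
    collect = solve-∀
    quadratic : sumTo n (λ k → 1ℤ + + 4 * (b k * b (k ℕ.+ s))) ≡ + n + + 4 * Q
    quadratic = begin
      sumTo n (λ k → 1ℤ + + 4 * (b k * b (k ℕ.+ s)))                ≡⟨ sumTo-+ n (λ _ → 1ℤ) (λ k → + 4 * (b k * b (k ℕ.+ s))) ⟩
      sumTo n (λ _ → 1ℤ) + sumTo n (λ k → + 4 * (b k * b (k ℕ.+ s)))  ≡⟨ cong₂ _+_ (sumTo-const n 1ℤ) (sumTo-*ˡ n (+ 4) (λ k → b k * b (k ℕ.+ s))) ⟩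
      + n * 1ℤ + + 4 * Q                                              ≡⟨ cong (_+ + 4 * Q) (*-identityʳ (+ n)) ⟩
      + n + + 4 * Q                                                   ∎
    linear : sumTo n (λ k → - + 2 * (b k + b (k ℕ.+ s))) ≡ - + 2 * (B + B)
    linear = begin
      sumTo n (λ k → - + 2 * (b k + b (k ℕ.+ s)))  ≡⟨ sumTo-*ˡ n (- + 2) (λ k → b k + b (k ℕ.+ s)) ⟩
      - + 2 * sumTo n (λ k → b k + b (k ℕ.+ s))    ≡⟨ cong (- + 2 *_) (sumTo-+ n b (λ k → b (k ℕ.+ s))) ⟩
      - + 2 * (B + sumTo n (λ k → b (k ℕ.+ s)))    ≡⟨ cong (λ z → - + 2 * (B + z)) (sumTo-shift n (cong negBit ∘ per) s) ⟩
      - + 2 * (B + B)                              ∎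

  autocorrelation-1-even : ∀ N {b : ℕ → ℤ} → Palindrome (suc (N ℕ.+ N)) b → Even (autocorrelation (N ℕ.+ N) b 1)
  autocorrelation-1-even N {b} pal =
    subst Even (sym (sumTo-palindrome N (λ k → b k * b (k ℕ.+ 1)) pairs)) (even-double (autocorrelation N b 1))
    where
    pairs : Palindrome (N ℕ.+ N) (λ k → b k * b (k ℕ.+ 1))
    pairs a c e = trans (cong₂ _*_ (pal a (c ℕ.+ 1) (cong suc (trans (shift₁ a c) e)))
                                   (pal (a ℕ.+ 1) c (cong suc (trans (shift₂ a c) e))))
                        (*-comm (b (c ℕ.+ 1)) (b c))
      where
      shift₁ : ∀ a c → a ℕ.+ (c ℕ.+ 1) ≡ suc (a ℕ.+ c)
      shift₁ = ℕ-Ring.solve-∀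
      shift₂ : ∀ a c → a ℕ.+ 1 ℕ.+ c ≡ suc (a ℕ.+ c)
      shift₂ = ℕ-Ring.solve-∀

  autocorrelation-even-lag : ∀ N .{{_ : NonZero N}} {b : ℕ → ℤ} →
    Periodic (N ℕ.+ N) b → Palindrome (suc (N ℕ.+ N)) b → (∀ k → b k * b k ≡ b k) →
    ∀ j → j ≤ N → Even (autocorrelation (N ℕ.+ N) b (j ℕ.+ j) - (b j + b (j ℕ.+ N)))
  autocorrelation-even-lag N {b} per pal idem j j≤N =
    subst Even (cong₂ _-_ (sumTo-shift n g-periodic c) ends) (sumTo-palindrome-ends N h h-palindrome)
    where
    n c : ℕ
    n = N ℕ.+ N
    c = n ∸ j
    c+j≡n : c ℕ.+ j ≡ n
    c+j≡n = ℕ.m∸n+n≡m (ℕ.≤-trans j≤N (ℕ.m≤m+n N N))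
    pal₂ : Palindrome (suc (n ℕ.+ n)) b
    pal₂ = palindrome-+period per ℕ.≤-refl pal
    pal₃ : Palindrome (suc (n ℕ.+ n ℕ.+ n)) b
    pal₃ = palindrome-+period per (ℕ.m≤m+n n n) pal₂
    g h : ℕ → ℤ
    g k = b k * b (k ℕ.+ (j ℕ.+ j))
    h k = g (k ℕ.+ c)
    g-periodic : Periodic n g
    g-periodic k = cong₂ _*_ (per k) (trans (cong b (swap k n (j ℕ.+ j))) (per (k ℕ.+ (j ℕ.+ j))))
      where
      swap : ∀ k n s → k ℕ.+ n ℕ.+ s ≡ k ℕ.+ s ℕ.+ n
      swap = ℕ-Ring.solve-∀
    -- shifting by c = 2N - j makes the reflection k ↦ -2j - k of the lag-2j terms the reflection k ↦ 2N - k
    h-palindrome : Palindrome (suc n) h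
    h-palindrome a a′ e = trans (cong₂ _*_ (pal₃ _ _ (cong suc three₁)) (pal₃ _ _ (cong suc three₂)))
                                (*-comm (b (a′ ℕ.+ c ℕ.+ (j ℕ.+ j))) (b (a′ ℕ.+ c)))
      where
      three : a ℕ.+ a′ ℕ.+ (c ℕ.+ j) ℕ.+ (c ℕ.+ j) ≡ n ℕ.+ n ℕ.+ n
      three = cong₂ ℕ._+_ (cong₂ ℕ._+_ (ℕ.suc-injective e) c+j≡n) c+j≡n
      regroup₁ : ∀ a a′ c j → a ℕ.+ c ℕ.+ (a′ ℕ.+ c ℕ.+ (j ℕ.+ j)) ≡ a ℕ.+ a′ ℕ.+ (c ℕ.+ j) ℕ.+ (c ℕ.+ j)
      regroup₁ = ℕ-Ring.solve-∀
      regroup₂ : ∀ a a′ c j → a ℕ.+ c ℕ.+ (j ℕ.+ j) ℕ.+ (a′ ℕ.+ c) ≡ a ℕ.+ a′ ℕ.+ (c ℕ.+ j) ℕ.+ (c ℕ.+ j)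
      regroup₂ = ℕ-Ring.solve-∀
      three₁ : a ℕ.+ c ℕ.+ (a′ ℕ.+ c ℕ.+ (j ℕ.+ j)) ≡ n ℕ.+ n ℕ.+ n
      three₁ = trans (regroup₁ a a′ c j) three
      three₂ : a ℕ.+ c ℕ.+ (j ℕ.+ j) ℕ.+ (a′ ℕ.+ c) ≡ n ℕ.+ n ℕ.+ n
      three₂ = trans (regroup₂ a a′ c j) three
    ends : h 0 + h N ≡ b j + b (j ℕ.+ N)
    ends = cong₂ _+_
      (trans (cong₂ _*_ (pal c j (cong suc c+j≡n)) (trans (cong b first) (per j))) (idem j))
      (trans (cong₂ _*_ (pal₂ _ _ (cong suc second₁)) (trans (cong b second₂) (per (j ℕ.+ N)))) (idem (j ℕ.+ N)))
      where
      regroup₀ : ∀ c j → c ℕ.+ (j ℕ.+ j) ≡ j ℕ.+ (c ℕ.+ j)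
      regroup₀ = ℕ-Ring.solve-∀
      regroup₁ : ∀ N c j → N ℕ.+ c ℕ.+ (j ℕ.+ N) ≡ N ℕ.+ N ℕ.+ (c ℕ.+ j)
      regroup₁ = ℕ-Ring.solve-∀
      regroup₂ : ∀ N c j → N ℕ.+ c ℕ.+ (j ℕ.+ j) ≡ j ℕ.+ N ℕ.+ (c ℕ.+ j)
      regroup₂ = ℕ-Ring.solve-∀
      first : c ℕ.+ (j ℕ.+ j) ≡ j ℕ.+ n
      first = trans (regroup₀ c j) (cong (j ℕ.+_) c+j≡n)
      second₁ : N ℕ.+ c ℕ.+ (j ℕ.+ N) ≡ n ℕ.+ n
      second₁ = trans (regroup₁ N c j) (cong (n ℕ.+_) c+j≡n)
      second₂ : N ℕ.+ c ℕ.+ (j ℕ.+ j) ≡ j ℕ.+ N ℕ.+ n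
      second₂ = trans (regroup₂ N c j) (cong (j ℕ.+ N ℕ.+_) c+j≡n)

  record SymmetricPM1 (n : ℕ) (x : ℕ → ℤ) : Set where
    field
      periodic   : Periodic n x
      palindrome : Palindrome (suc n) x
      pm1        : ∀ k → PlusMinusOne (x k)

  at-cong : ∀ {n} .{{_ : NonZero n}} (X : Seq n) {a c} → a % n ≡ c % n → at X a ≡ at X c
  at-cong {n} X {a} {c} e = cong X (fromℕ<-cong (a % n) (c % n) e (m%n<n a n) (m%n<n c n))

  at-periodic : ∀ {n} .{{_ : NonZero n}} (X : Seq n) → Periodic n (at X)
  at-periodic {n} X k = at-cong X ([m+n]%n≡m%n k n)

  at-palindrome : ∀ {n} .{{_ : NonZero n}} (X : Seq n) → Symmetric X → Palindrome (suc n) (at X)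
  at-palindrome {n} X symmetric a c e = mirror a c (ℕ.suc-injective e)
    where
    mirror : ∀ a c → a ℕ.+ c ≡ n → at X a ≡ at X c
    mirror zero    c       e = sym (trans (cong (at X) e) (at-periodic X 0))
    mirror (suc a) zero    e = sym (mirror zero (suc a) (trans (sym (ℕ.+-identityʳ (suc a))) e))
    mirror (suc a) (suc c) e = trans (symmetric (suc a) (s≤s z≤n) a<n) (cong (at X) n∸a≡c)
      where
      a<n : suc a < n
      a<n = subst (suc a <_) e (ℕ.m<m+n (suc a) (s≤s z≤n))
      n∸a≡c : n ∸ suc a ≡ suc c
      n∸a≡c = trans (cong (_∸ suc a) (sym e)) (ℕ.m+n∸m≡n (suc a) (suc c))

  at-symmetricPM1 : ∀ {n} .{{_ : NonZero n}} (X : Seq n) → IsPM1 X → Symmetric X → SymmetricPM1 n (at X)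
  at-symmetricPM1 X pm symmetric = record
    { periodic   = at-periodic X
    ; palindrome = at-palindrome X symmetric
    ; pm1        = λ k → pm _
    }

  -- Families of symmetric ±1 sequences with vanishing total autocorrelation

  module Family {N : ℕ} .{{_ : NonZero N}} (r : ℕ) (x : ℕ → ℕ → ℤ)
    (symmetric : ∀ t → SymmetricPM1 (N ℕ.+ N) (x t))
    (cancels : ∀ s → 1 ≤ s → s ≤ N → sumTo r (λ t → autocorrelation (N ℕ.+ N) (x t) s) ≡ 0ℤ) where

    open SymmetricPM1

    n : ℕ
    n = N ℕ.+ N

    β : ℕ → ℕ → ℤ
    β t = negBit ∘ x t

    β-periodic : ∀ t → Periodic n (β t)
    β-periodic t k = cong negBit (periodic (symmetric t) k)

    β-palindrome : ∀ t → Palindrome (suc n) (β t)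
    β-palindrome t a c e = cong negBit (palindrome (symmetric t) a c e)

    weight : ℕ → ℤ
    weight t = sumTo n (β t)

    correlation : ℕ → ℤ
    correlation s = sumTo r (λ t → autocorrelation n (β t) s)

    sumTo-autocorrelation : ∀ s →
      sumTo r (λ t → autocorrelation n (x t) s) ≡ + r * + n + + 4 * (correlation s - sumTo r weight)
    sumTo-autocorrelation s = begin
      sumTo r (λ t → autocorrelation n (x t) s)
        ≡⟨ sumTo-cong r (λ t _ → autocorrelation-pm1 n (periodic (symmetric t)) (pm1 (symmetric t)) s) ⟩
      sumTo r (λ t → + n + + 4 * (autocorrelation n (β t) s - weight t))
        ≡⟨ sumTo-+ r (λ _ → + n) (λ t → + 4 * (autocorrelation n (β t) s - weight t)) ⟩
      sumTo r (λ _ → + n) + sumTo r (λ t → + 4 * (autocorrelation n (β t) s - weight t))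
        ≡⟨ cong₂ _+_ (sumTo-const r (+ n))
                     (trans (sumTo-*ˡ r (+ 4) _) (cong (+ 4 *_) (sumTo-sub r (λ t → autocorrelation n (β t) s) weight))) ⟩
      + r * + n + + 4 * (correlation s - sumTo r weight)
        ∎

    correlation-constant : ∀ s → 1 ≤ s → s ≤ N → correlation s ≡ correlation 1
    correlation-constant s 1≤s s≤N =
      ∙-cancelʳ (- sumTo r weight) (correlation s) (correlation 1)
        (*-cancelˡ-≡ (+ 4) _ _ (∙-cancelˡ (+ r * + n) _ _ (begin
          + r * + n + + 4 * (correlation s - sumTo r weight)  ≡⟨ sumTo-autocorrelation s ⟨
          sumTo r (λ t → autocorrelation n (x t) s)           ≡⟨ cancels s 1≤s s≤N ⟩
          0ℤ                                                  ≡⟨ cancels 1 ℕ.≤-refl (ℕ.>-nonZero⁻¹ N) ⟨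
          sumTo r (λ t → autocorrelation n (x t) 1)           ≡⟨ sumTo-autocorrelation 1 ⟩
          + r * + n + + 4 * (correlation 1 - sumTo r weight)  ∎)))

    correlation-1-even : Even (correlation 1)
    correlation-1-even = sumTo-even r (λ t _ → autocorrelation-1-even N (β-palindrome t))

    negatives : ℕ → ℤ
    negatives i = sumTo r (λ t → β t i + β t (i ℕ.+ N))

    negatives-2j≤N : ∀ j → 1 ≤ j ℕ.+ j → j ℕ.+ j ≤ N → Even (negatives j)
    negatives-2j≤N j 1≤2j 2j≤N =
      subst Even (recover (correlation (j ℕ.+ j)) (negatives j)) (∣m∣n⇒∣m-n correlation-even (subst Even
        (sumTo-sub r (λ t → autocorrelation n (β t) (j ℕ.+ j)) (λ t → β t j + β t (j ℕ.+ N)))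
        (sumTo-even r (λ t _ → autocorrelation-even-lag N (β-periodic t) (β-palindrome t) (negBit-idem ∘ x t) j j≤N))))
      where
      j≤N : j ≤ N
      j≤N = ℕ.≤-trans (ℕ.m≤m+n j j) 2j≤N
      correlation-even : Even (correlation (j ℕ.+ j))
      correlation-even = subst Even (sym (correlation-constant (j ℕ.+ j) 1≤2j 2j≤N)) correlation-1-even
      recover : ∀ q p → q - (q - p) ≡ p
      recover = solve-∀

    negatives-mirror : ∀ i j → j ℕ.+ i ≡ N → negatives j ≡ negatives i
    negatives-mirror i j e = sumTo-cong r (λ t _ →
      trans (cong₂ _+_ (β-palindrome t j (i ℕ.+ N) (cong suc e₁)) (β-palindrome t (j ℕ.+ N) i (cong suc e₂)))
            (+-comm (β t (i ℕ.+ N)) (β t i)))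
      where
      e₁ : j ℕ.+ (i ℕ.+ N) ≡ n
      e₁ = trans (sym (ℕ.+-assoc j i N)) (cong (ℕ._+ N) e)
      swap : ∀ j N i → j ℕ.+ N ℕ.+ i ≡ j ℕ.+ i ℕ.+ N
      swap = ℕ-Ring.solve-∀
      e₂ : j ℕ.+ N ℕ.+ i ≡ n
      e₂ = trans (swap j N i) (cong (ℕ._+ N) e)

    negatives-0<i : ∀ i → 0 < i → i < N → Even (negatives i)
    negatives-0<i i 0<i i<N with i ℕ.+ i ≤? N
    ... | yes 2i≤N = negatives-2j≤N i (ℕ.≤-trans 0<i (ℕ.m≤m+n i i)) 2i≤N
    ... | no  2i≰N = subst Even (negatives-mirror i j j+i≡N) (negatives-2j≤N j (ℕ.≤-trans 0<j (ℕ.m≤m+n j j)) 2j≤N)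
      where
      j : ℕ
      j = N ∸ i
      j+i≡N : j ℕ.+ i ≡ N
      j+i≡N = ℕ.m∸n+n≡m (ℕ.<⇒≤ i<N)
      0<j : 0 < j
      0<j = ℕ.m<n⇒0<n∸m i<N
      j<i : j < i
      j<i = ℕ.+-cancelʳ-< i j i (subst (_< i ℕ.+ i) (sym j+i≡N) (ℕ.≰⇒> 2i≰N))
      2j≤N : j ℕ.+ j ≤ N
      2j≤N = subst (j ℕ.+ j ≤_) j+i≡N (ℕ.+-monoʳ-≤ j (ℕ.<⇒≤ j<i))

    sumTo-negatives : sumTo N negatives ≡ sumTo r weight
    sumTo-negatives = trans (sumTo-swap N r (λ t i → β t i + β t (i ℕ.+ N)))
                            (sumTo-cong r (λ t _ → sym (sumTo-halves N (β t))))

    negatives-even : Even (sumTo r weight) → ∀ i → i < N → Even (negatives i)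
    negatives-even even-weight zero    0<N = even-first-term N 0<N (subst Even (sym sumTo-negatives) even-weight) negatives-0<i
    negatives-even even-weight (suc i) i<N = negatives-0<i (suc i) (s≤s z≤n) i<N

    columns-equal : ∀ i → Even (negatives i) → productTo r (λ t → x t i) ≡ productTo r (λ t → x t (i ℕ.+ N))
    columns-equal i even = productTo-≡ r (λ t → pm1 (symmetric t) i) (λ t → pm1 (symmetric t) (i ℕ.+ N))
      (subst Even (sumTo-+ r (λ t → β t i) (λ t → β t (i ℕ.+ N))) even)

  williamson-columns : ∀ {N} .{{_ : NonZero N}} (x : ℕ → ℕ → ℤ) → (∀ t → SymmetricPM1 (N ℕ.+ N) (x t)) →
    (∀ s → 1 ≤ s → s ≤ N → sumTo 4 (λ t → autocorrelation (N ℕ.+ N) (x t) s) ≡ 0ℤ) →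
    ∀ i → i < N → productTo 4 (λ t → x t i) ≡ productTo 4 (λ t → x t (i ℕ.+ N))
  williamson-columns {N} x symmetric cancels i i<N = columns-equal i (negatives-even weight-even i i<N)
    where
    open Family 4 x symmetric cancels
    balanced : + n + (correlation 1 - sumTo 4 weight) ≡ 0ℤ
    balanced = *-cancelˡ-≡ (+ 4) (+ n + (correlation 1 - sumTo 4 weight)) 0ℤ (begin
      + 4 * (+ n + (correlation 1 - sumTo 4 weight))      ≡⟨ *-distribˡ-+ (+ 4) (+ n) _ ⟩
      + 4 * + n + + 4 * (correlation 1 - sumTo 4 weight)  ≡⟨ sumTo-autocorrelation 1 ⟨
      sumTo 4 (λ t → autocorrelation n (x t) 1)           ≡⟨ cancels 1 ℕ.≤-refl (ℕ.>-nonZero⁻¹ N) ⟩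
      0ℤ                                                  ≡⟨ *-zeroʳ (+ 4) ⟨
      + 4 * 0ℤ                                            ∎)
    rearrange : ∀ w m c → w ≡ (m + c) - (m + (c - w))
    rearrange = solve-∀
    weight-even : Even (sumTo 4 weight)
    weight-even = subst Even (sym (begin
      sumTo 4 weight                                                    ≡⟨ rearrange (sumTo 4 weight) (+ n) (correlation 1) ⟩
      (+ n + correlation 1) - (+ n + (correlation 1 - sumTo 4 weight))  ≡⟨ cong (λ z → (+ n + correlation 1) - z) balanced ⟩
      (+ n + correlation 1) - 0ℤ                                        ≡⟨ +-identityʳ (+ n + correlation 1) ⟩
      + n + correlation 1                                               ≡⟨ cong (_+ correlation 1) (pos-+ N N) ⟩
      (+ N + + N) + correlation 1                                       ∎))
      (∣m∣n⇒∣m+n (even-double (+ N)) correlation-1-even)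

  -- every index t ≥ 3 names D
  quadruple : ∀ {n} .{{_ : NonZero n}} → Seq n → Seq n → Seq n → Seq n → ℕ → ℕ → ℤ
  quadruple A B C D 0 = at A
  quadruple A B C D 1 = at B
  quadruple A B C D 2 = at C
  quadruple A B C D _ = at D

  2*N≡N+N : ∀ N → 2 ℕ.* N ≡ N ℕ.+ N
  2*N≡N+N N = cong (N ℕ.+_) (ℕ.+-identityʳ N)

  quadruple-symmetric : ∀ m (A B C D : Seq (2 ℕ.* suc m)) → Williamson A B C D →
                        ∀ t → SymmetricPM1 (suc m ℕ.+ suc m) (quadruple A B C D t)
  quadruple-symmetric m A B C D ((pa , pb , pc , pd) , (sa , sb , sc , sd) , _) t =
    subst (λ n → SymmetricPM1 n (quadruple A B C D t)) (2*N≡N+N (suc m)) (member t)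
    where
    member : ∀ t → SymmetricPM1 (2 ℕ.* suc m) (quadruple A B C D t)
    member 0                   = at-symmetricPM1 A pa sa
    member 1                   = at-symmetricPM1 B pb sb
    member 2                   = at-symmetricPM1 C pc sc
    member (suc (suc (suc _))) = at-symmetricPM1 D pd sd

  quadruple-cancels : ∀ m (A B C D : Seq (2 ℕ.* suc m)) → Williamson A B C D →
    ∀ s → 1 ≤ s → s ≤ suc m → sumTo 4 (λ t → autocorrelation (suc m ℕ.+ suc m) (quadruple A B C D t) s) ≡ 0ℤ
  quadruple-cancels m A B C D (_ , _ , cancel) s 1≤s s≤N = begin
    sumTo 4 (λ t → autocorrelation (N ℕ.+ N) (quadruple A B C D t) s)
      ≡⟨ cong (λ n → sumTo 4 (λ t → autocorrelation n (quadruple A B C D t) s)) (2*N≡N+N N) ⟨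
    0ℤ + PAF A s + PAF B s + PAF C s + PAF D s
      ≡⟨ cong (λ z → z + PAF B s + PAF C s + PAF D s) (+-identityˡ (PAF A s)) ⟩
    PAF A s + PAF B s + PAF C s + PAF D s
      ≡⟨ cancel s 1≤s (subst (s ≤_) (sym half) s≤N) ⟩
    0ℤ
      ∎
    where
    N : ℕ
    N = suc m
    half : 2 ℕ.* N / 2 ≡ N
    half = trans (cong (_/ 2) (ℕ.*-comm 2 N)) (m*n/n≡m N 2)

open WilliamsonParity
open import Data.Nat using (ℕ; suc; _*_; _+_; _<_)
open import Data.Integer using () renaming (_*_ to _*ℤ_)
open import Relation.Binary.PropositionalEquality using (_≡_; module ≡-Reasoning)

theorem5 : (m : ℕ) → (A B C D : Seq (2 * suc m)) → Williamson A B C D →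
    ∀ (i : ℕ) → i < suc m →
      at A i *ℤ at B i *ℤ at C i *ℤ at D i
        ≡ at A (i + suc m) *ℤ at B (i + suc m) *ℤ at C (i + suc m) *ℤ at D (i + suc m)
theorem5 m A B C D W i i<N = begin
  at A i *ℤ at B i *ℤ at C i *ℤ at D i
    ≡⟨ productTo-4 (λ t → quadruple A B C D t i) ⟨
  productTo 4 (λ t → quadruple A B C D t i)
    ≡⟨ williamson-columns (quadruple A B C D) (quadruple-symmetric m A B C D W) (quadruple-cancels m A B C D W) i i<N ⟩
  productTo 4 (λ t → quadruple A B C D t (i + suc m))
    ≡⟨ productTo-4 (λ t → quadruple A B C D t (i + suc m)) ⟩
  at A (i + suc m) *ℤ at B (i + suc m) *ℤ at C (i + suc m) *ℤ at D (i + suc m)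
    ∎
  where open ≡-Reasoning
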